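{- Let $m(i,j)$ and $c(j,k)$ be the integer matrices defined below. Then for all integers $j\ge1$ and $k\ge1$, \begin{align*} \nu_3(c(2j-1,k)) &\ge 2j+\delta_{k,1}+\left\lfloor\frac{9k-10}{2}\right\rfloor,\\ \nu_3(c(2j,k)) &\ge 2j+2+\delta_{k,1}+\left\lfloor\frac{9k-10}{2}\right\rfloor, \end{align*} where $\delta_{k,1}$ is $1$ if $k=1$ and $0$ otherwise.
   Context: $\nu_3(n)$ denotes the exponent of the highest power of $3$ dividing $n$, with $\nu_3(0)=\infty$. The matrix $\{m(i,j)\}_{i,j\ge1}$ is defined by (with $m(i,j)=0$ for $i\le0$): $m(1,1)=9$, $m(2,1)=6$, $m(3,1)=1$, $m(i,1)=0$ for $i\ge4$, and for $j\ge2$, $m(i,j)=27m(i-1,j-1)+9m(i-2,j-1)+m(i-3,j-1)$. The matrix $\{c(j,k)\}_{j,k\ge1}$ is defined by $c(1,1)=9$, $c(1,k)=0$ for $k\ge2$, and for $j,k\ge1$: $c(j+1,k)=\sum_{i\ge1}c(j,i)m(4i,i+k)$ if $j$ is odd, and $c(j+1,k)=\sum_{i\ge1}c(j,i)m(4i+2,i+k)$ if $j$ is even (finite sums). -}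

module Defs where

open import Data.Nat as ℕ using (ℕ; zero; suc; _+_; _*_; _∸_; _%_; _/_; _≡ᵇ_)
open import Data.Bool using (Bool; true; false; if_then_else_)
open import Data.Integer as ℤ using (ℤ; +_)
import Data.Integer.DivMod as ℤDM
open import Data.Unit using (⊤)

-- The matrix m(i,j), 1-indexed; all entries with i ≤ 0 (here i = 0) or j = 0 are 0.
-- Entries are nonnegative integers, so we take values in ℕ.
m : ℕ → ℕ → ℕ
m zero    _  = 0
m (suc i) zero = 0
m 1 1 = 9
m 2 1 = 6
m 3 1 = 1
m (suc (suc (suc (suc _)))) 1 = 0
m (suc i) (suc (suc j)) =
  27 * m i (suc j) + 9 * m (i ∸ 1) (suc j) + m (i ∸ 2) (suc j)
  -- i ∸ 1, i ∸ 2 truncate at 0, where m vanishes, matching m(i,j)=0 for i ≤ 0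

Σ₁ : ℕ → (ℕ → ℕ) → ℕ
Σ₁ zero    f = 0
Σ₁ (suc n) f = Σ₁ n f + f (suc n)

odd? : ℕ → Bool
odd? n = (n % 2) ≡ᵇ 1

-- The (finite) sums over i ≥ 1 are taken over
-- 1 ≤ i ≤ 3k: since m(a,b) = 0 unless b ≤ a ≤ 3b, the terms m(4i,i+k) and
-- m(4i+2,i+k) vanish for i > 3k, so this is exactly the defining sum.
c : ℕ → ℕ → ℕ
c zero _ = 0
c 1 k = if k ≡ᵇ 1 then 9 else 0
c (suc (suc j)) k =
  if odd? (suc j)
  then Σ₁ (3 * k) (λ i → c (suc j) i * m (4 * i) (i + k))
  else Σ₁ (3 * k) (λ i → c (suc j) i * m (4 * i + 2) (i + k))

data ℕ∞ : Set where
  fin : ℕ → ℕ∞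
  ∞   : ℕ∞

-- 3-adic valuation of a positive n, using fuel (fuel ≥ n suffices)
val3 : ℕ → ℕ → ℕ
val3 zero    n = 0
val3 (suc f) zero = 0
val3 (suc f) (suc n) with (suc n) % 3 ≡ᵇ 0
... | true  = suc (val3 f ((suc n) / 3))
... | false = 0

ν₃ : ℕ → ℕ∞
ν₃ zero    = ∞
ν₃ (suc n) = fin (val3 (suc n) (suc n))

infix 4 _≤∞_
_≤∞_ : ℤ → ℕ∞ → Set
b ≤∞ ∞     = ⊤
b ≤∞ fin v = b ℤ.≤ + v

δ₁ : ℕ → ℤ
δ₁ k = if k ≡ᵇ 1 then + 1 else + 0

-- ⌊(9k-10)/2⌋ as an integer (Euclidean division by 2 = floor division)
fl : ℕ → ℤ
fl k = ((+ (9 * k)) ℤ.- (+ 10)) ℤDM./ (+ 2)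

-- With d = 3b − a, induction on b through the recurrence gives 3^f(d) ∣ m(a,b), where
-- f(d) = ⌈3d/2⌉ − 1 for d ≥ 1, f(0) = 0, and m(a,b) = 0 once a > 3b.  In
-- c(j+1,k) = Σᵢ c(j,i) m(4i+ε, i+k) the m-factor has d = 3k − i (ε = 0) or 3k − i − 2 (ε = 2),
-- so by induction on j it suffices that e(i) + f(3k − i) ≥ e(k) + 2, resp. e(i) + f(3k − i − 2) ≥ e(k),
-- for e(k) = ⌊(9k − 10)/2⌋; these follow from 9k − 11 ≤ 2e(k) ≤ 9k − 10 and 3d ≤ 2f(d) + 2.
module Submission where

open import Defs

module PowersOfThree where

  open import Data.Bool using (true; false)
  import Data.Integer as ℤ
  open import Data.Product using (_,_)
  open import Data.Nat
  open import Data.Nat.DivMod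
  open import Data.Nat.Divisibility
  open import Data.Nat.Properties
  open import Data.Nat.Tactic.RingSolver using (solve-∀)
  open import Relation.Binary.PropositionalEquality

  ^-monoʳ-∣ : ∀ p {a b} → a ≤ b → p ^ a ∣ p ^ b
  ^-monoʳ-∣ p {a} a≤b with m≤n⇒∃[o]m+o≡n a≤b
  ... | o , refl = divides (p ^ o) (trans (^-distribˡ-+-* p a o) (*-comm (p ^ a) (p ^ o)))

  *-pres-^-∣ : ∀ p s {t r x y} → r ≤ s + t → p ^ s ∣ x → p ^ t ∣ y → p ^ r ∣ x * y
  *-pres-^-∣ p s {t} r≤s+t p^s∣x p^t∣y =
    ∣-trans (^-monoʳ-∣ p r≤s+t) (subst (_∣ _) (sym (^-distribˡ-+-* p s t)) (*-pres-∣ p^s∣x p^t∣y))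

  Σ₁-pres-∣ : ∀ {D} n g → (∀ i → 1 ≤ i → D ∣ g i) → D ∣ Σ₁ n g
  Σ₁-pres-∣ zero    g D∣g = _ ∣0
  Σ₁-pres-∣ (suc n) g D∣g = ∣m∣n⇒∣m+n (Σ₁-pres-∣ n g D∣g) (D∣g (suc n) (s≤s z≤n))

  ≤-from-double : ∀ x y c → 2 * x + c ≤ 2 * y + 1 + c → x ≤ y
  ≤-from-double x y c le = s≤s⁻¹ (*-cancelˡ-< 2 x (suc y)
    (subst (2 * x <_) (double-suc y) (s≤s (+-cancelʳ-≤ c (2 * x) (2 * y + 1) le))))
    where
    double-suc : ∀ y → suc (2 * y + 1) ≡ 2 * suc y
    double-suc = solve-∀

  -- For d ≥ 1, mExponent d = ⌈3d/2⌉ − 1.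
  mExponent : ℕ → ℕ
  mExponent 0 = 0
  mExponent 1 = 1
  mExponent 2 = 2
  mExponent (suc (suc (suc d))) = 3 + mExponent (suc d)

  mExponent-suc : ∀ d → mExponent (suc d) ≤ 2 + mExponent d
  mExponent-suc 0 = s≤s z≤n
  mExponent-suc 1 = s≤s (s≤s z≤n)
  mExponent-suc 2 = ≤-refl
  mExponent-suc (suc (suc (suc d))) = +-monoʳ-≤ 3 (mExponent-suc (suc d))

  mExponent-2+ : ∀ d → mExponent (2 + d) ≤ 3 + mExponent d
  mExponent-2+ zero    = s≤s (s≤s z≤n)
  mExponent-2+ (suc d) = ≤-refl

  3*d≤2*mExponent+2 : ∀ d → 3 * d ≤ 2 * mExponent d + 2
  3*d≤2*mExponent+2 0 = z≤n
  3*d≤2*mExponent+2 1 = s≤s (s≤s (s≤s z≤n))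
  3*d≤2*mExponent+2 2 = ≤-refl
  3*d≤2*mExponent+2 (suc (suc (suc d))) = begin
    3 * (3 + d)                   ≡⟨ e₁ d ⟩
    6 + 3 * suc d                 ≤⟨ +-monoʳ-≤ 6 (3*d≤2*mExponent+2 (suc d)) ⟩
    6 + (2 * mExponent (suc d) + 2) ≡⟨ e₂ (mExponent (suc d)) ⟩
    2 * (3 + mExponent (suc d)) + 2 ∎
    where
    open ≤-Reasoning
    e₁ : ∀ d → 3 * (3 + d) ≡ 6 + 3 * suc d
    e₁ = solve-∀
    e₂ : ∀ x → 6 + (2 * x + 2) ≡ 2 * (3 + x) + 2
    e₂ = solve-∀

  -- N ≤ mExponent (3b − a); it holds vacuously when a > 3b.
  MBound : ℕ → ℕ → ℕ → Set
  MBound N a b = ∀ d → a + d ≡ 3 * b → N ≤ mExponent d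

  MBound-27 : ∀ {N i b} → MBound N (suc i) (2 + b) → MBound (N ∸ 3) i (suc b)
  MBound-27 {N} {i} {b} H d i+d≡3b = m≤n+o⇒m∸n≤o N 3 (≤-trans (H (2 + d) shifted) (mExponent-2+ d))
    where
    open ≡-Reasoning
    shifted : suc i + (2 + d) ≡ 3 * (2 + b)
    shifted = begin
      suc i + (2 + d) ≡⟨ +-suc (suc i) (suc d) ⟩
      2 + (i + suc d) ≡⟨ cong (2 +_) (+-suc i d) ⟩
      3 + (i + d)     ≡⟨ cong (3 +_) i+d≡3b ⟩
      3 + 3 * suc b   ≡⟨ *-suc 3 (suc b) ⟨
      3 * (2 + b)     ∎

  MBound-9 : ∀ {N i b} → MBound N (2 + i) (2 + b) → MBound (N ∸ 2) i (suc b)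
  MBound-9 {N} {i} {b} H d i+d≡3b = m≤n+o⇒m∸n≤o N 2 (≤-trans (H (suc d) shifted) (mExponent-suc d))
    where
    open ≡-Reasoning
    shifted : 2 + i + suc d ≡ 3 * (2 + b)
    shifted = begin
      2 + i + suc d ≡⟨ cong (2 +_) (+-suc i d) ⟩
      3 + (i + d)   ≡⟨ cong (3 +_) i+d≡3b ⟩
      3 + 3 * suc b ≡⟨ *-suc 3 (suc b) ⟨
      3 * (2 + b)   ∎

  MBound-1 : ∀ {N i b} → MBound N (3 + i) (2 + b) → MBound N i (suc b)
  MBound-1 {b = b} H d i+d≡3b = H d (trans (cong (3 +_) i+d≡3b) (sym (*-suc 3 (suc b))))

  m-recurrence : ∀ i b → m (suc i) (2 + b) ≡ 27 * m i (suc b) + 9 * m (i ∸ 1) (suc b) + m (i ∸ 2) (suc b)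
  m-recurrence 0 b = refl
  m-recurrence 1 b = refl
  m-recurrence 2 b = refl
  m-recurrence (suc (suc (suc i))) b = refl

  -- When a > 3b this says m a b = 0.
  3^∣m : ∀ N a b → MBound N a b → 3 ^ N ∣ m a b
  3^∣m N 0 b H = _ ∣0
  3^∣m N (suc a) 0 H = _ ∣0
  3^∣m N 1 1 H = ^-monoʳ-∣ 3 (H 2 refl)
  3^∣m N 2 1 H = ∣-trans (^-monoʳ-∣ 3 (H 1 refl)) (divides 2 refl)
  3^∣m N 3 1 H = ^-monoʳ-∣ 3 (H 0 refl)
  3^∣m N (suc (suc (suc (suc a)))) 1 H = _ ∣0
  3^∣m N (suc i) (suc (suc b)) H = subst (3 ^ N ∣_) (sym (m-recurrence i b))
    (∣m∣n⇒∣m+n (∣m∣n⇒∣m+n term₂₇ (term₉ i H)) (term₁ i H))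
    where
    term₂₇ : 3 ^ N ∣ 27 * m i (suc b)
    term₂₇ = *-pres-^-∣ 3 3 (m≤n+m∸n N 3) ∣-refl (3^∣m (N ∸ 3) i (suc b) (MBound-27 H))
    term₉ : ∀ i → MBound N (suc i) (2 + b) → 3 ^ N ∣ 9 * m (i ∸ 1) (suc b)
    term₉ zero    _ = _ ∣0
    term₉ (suc i) H = *-pres-^-∣ 3 2 (m≤n+m∸n N 2) ∣-refl (3^∣m (N ∸ 2) i (suc b) (MBound-9 H))
    term₁ : ∀ i → MBound N (suc i) (2 + b) → 3 ^ N ∣ m (i ∸ 2) (suc b)
    term₁ 0 _ = _ ∣0
    term₁ 1 _ = _ ∣0
    term₁ (suc (suc i)) H = 3^∣m N i (suc b) (MBound-1 H)

  m≤2*[m/2]+1 : ∀ m → m ≤ 2 * (m / 2) + 1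
  m≤2*[m/2]+1 m = begin
    m                 ≡⟨ m≡m%n+[m/n]*n m 2 ⟩
    m % 2 + m / 2 * 2 ≤⟨ +-monoˡ-≤ (m / 2 * 2) (s≤s⁻¹ (m%n<n m 2)) ⟩
    1 + m / 2 * 2     ≡⟨ trans (+-comm 1 _) (cong (_+ 1) (*-comm (m / 2) 2)) ⟩
    2 * (m / 2) + 1   ∎
    where open ≤-Reasoning

  2*[m/2]≤m : ∀ m → 2 * (m / 2) ≤ m
  2*[m/2]≤m m = ≤-trans (≤-reflexive (*-comm 2 (m / 2))) (m/n*n≤m m 2)

  -- For k ≥ 1 this is δ_{k,1} + ⌊(9k − 10)/2⌋.
  cExponent : ℕ → ℕ
  cExponent k = (9 * k ∸ 10) / 2

  9*k≤2*cExponent+11 : ∀ k → 9 * k ≤ 2 * cExponent k + 11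
  9*k≤2*cExponent+11 k = begin
    9 * k                  ≤⟨ m≤n+m∸n (9 * k) 10 ⟩
    10 + (9 * k ∸ 10)      ≤⟨ +-monoʳ-≤ 10 (m≤2*[m/2]+1 (9 * k ∸ 10)) ⟩
    10 + (2 * cExponent k + 1) ≡⟨ trans (+-comm 10 _) (+-assoc _ 1 10) ⟩
    2 * cExponent k + 11   ∎
    where open ≤-Reasoning

  2*cExponent+10≤9*k : ∀ k → 2 ≤ k → 2 * cExponent k + 10 ≤ 9 * k
  2*cExponent+10≤9*k k 2≤k = begin
    2 * cExponent k + 10 ≤⟨ +-monoˡ-≤ 10 (2*[m/2]≤m (9 * k ∸ 10)) ⟩
    9 * k ∸ 10 + 10      ≡⟨ m∸n+n≡m (≤-trans (m≤m+n 10 8) (*-monoʳ-≤ 9 2≤k)) ⟩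
    9 * k                ∎
    where open ≤-Reasoning

  cExponent-odd-step : ∀ {i k d} → 1 ≤ i → i + d ≡ 3 * k → cExponent k + 2 ≤ cExponent i + mExponent d
  cExponent-odd-step {1} {1} _ refl = ≤-refl
  cExponent-odd-step {2} {1} _ refl = s≤s (s≤s z≤n)
  cExponent-odd-step {3} {1} _ refl = s≤s (s≤s z≤n)
  cExponent-odd-step {suc (suc (suc (suc i)))} {1} _ ()
  cExponent-odd-step {i} {k@(suc (suc _))} {d} 1≤i i+d≡3k =
    ≤-from-double (cExponent k + 2) (cExponent i + mExponent d) 12 (begin
      2 * (cExponent k + 2) + 12            ≡⟨ e₁ (cExponent k) ⟩
      (2 * cExponent k + 10) + 6 * 1        ≤⟨ +-monoʳ-≤ _ (*-monoʳ-≤ 6 1≤i) ⟩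
      (2 * cExponent k + 10) + 6 * i        ≤⟨ +-monoˡ-≤ _ (2*cExponent+10≤9*k k (s≤s (s≤s z≤n))) ⟩
      9 * k + 6 * i                         ≡⟨ cong (_+ 6 * i) (trans (*-assoc 3 3 k) (cong (3 *_) (sym i+d≡3k))) ⟩
      3 * (i + d) + 6 * i                   ≡⟨ e₂ i d ⟩
      9 * i + 3 * d                         ≤⟨ +-mono-≤ (9*k≤2*cExponent+11 i) (3*d≤2*mExponent+2 d) ⟩
      (2 * cExponent i + 11) + (2 * mExponent d + 2) ≡⟨ e₃ (cExponent i) (mExponent d) ⟩
      2 * (cExponent i + mExponent d) + 1 + 12 ∎)
    where
    open ≤-Reasoning
    e₁ : ∀ c → 2 * (c + 2) + 12 ≡ (2 * c + 10) + 6 * 1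
    e₁ = solve-∀
    e₂ : ∀ i d → 3 * (i + d) + 6 * i ≡ 9 * i + 3 * d
    e₂ = solve-∀
    e₃ : ∀ c e → (2 * c + 11) + (2 * e + 2) ≡ 2 * (c + e) + 1 + 12
    e₃ = solve-∀

  cExponent-even-step : ∀ {i k d} → 1 ≤ i → i + (2 + d) ≡ 3 * k → cExponent k ≤ cExponent i + mExponent d
  cExponent-even-step {k = 0} _ _ = z≤n
  cExponent-even-step {k = 1} _ _ = z≤n
  cExponent-even-step {1} {k@(suc (suc _))} {d} _ 3+d≡3k =
    ≤-from-double (cExponent k) (mExponent d) 10 (begin
      2 * cExponent k + 10      ≤⟨ 2*cExponent+10≤9*k k (s≤s (s≤s z≤n)) ⟩
      9 * k                     ≡⟨ trans (*-assoc 3 3 k) (cong (3 *_) (sym 3+d≡3k)) ⟩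
      3 * (3 + d)               ≡⟨ e₁ d ⟩
      3 * d + 9                 ≤⟨ +-monoˡ-≤ 9 (3*d≤2*mExponent+2 d) ⟩
      (2 * mExponent d + 2) + 9 ≡⟨ e₂ (mExponent d) ⟩
      2 * mExponent d + 1 + 10  ∎)
    where
    open ≤-Reasoning
    e₁ : ∀ d → 3 * (3 + d) ≡ 3 * d + 9
    e₁ = solve-∀
    e₂ : ∀ e → (2 * e + 2) + 9 ≡ 2 * e + 1 + 10
    e₂ = solve-∀
  cExponent-even-step {i@(suc (suc i′))} {k@(suc (suc _))} {d} _ i+2+d≡3k =
    ≤-from-double (cExponent k) (cExponent i + mExponent d) 22 (begin
      2 * cExponent k + 22                  ≤⟨ m≤m+n _ (6 * i′) ⟩
      2 * cExponent k + 22 + 6 * i′         ≡⟨ e₁ (cExponent k) i′ ⟩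
      (2 * cExponent k + 10) + 6 * i        ≤⟨ +-monoˡ-≤ _ (2*cExponent+10≤9*k k (s≤s (s≤s z≤n))) ⟩
      9 * k + 6 * i                         ≡⟨ cong (_+ 6 * i) (trans (*-assoc 3 3 k) (cong (3 *_) (sym i+2+d≡3k))) ⟩
      3 * (i + (2 + d)) + 6 * i             ≡⟨ e₂ i d ⟩
      9 * i + 3 * d + 6                     ≤⟨ +-monoˡ-≤ 6 (+-mono-≤ (9*k≤2*cExponent+11 i) (3*d≤2*mExponent+2 d)) ⟩
      (2 * cExponent i + 11) + (2 * mExponent d + 2) + 6 ≤⟨ m≤m+n _ 4 ⟩
      (2 * cExponent i + 11) + (2 * mExponent d + 2) + 6 + 4 ≡⟨ e₃ (cExponent i) (mExponent d) ⟩
      2 * (cExponent i + mExponent d) + 1 + 22 ∎)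
    where
    open ≤-Reasoning
    e₁ : ∀ c i′ → 2 * c + 22 + 6 * i′ ≡ (2 * c + 10) + 6 * (2 + i′)
    e₁ = solve-∀
    e₂ : ∀ i d → 3 * (i + (2 + d)) + 6 * i ≡ 9 * i + 3 * d + 6
    e₂ = solve-∀
    e₃ : ∀ c e → (2 * c + 11) + (2 * e + 2) + 6 + 4 ≡ 2 * (c + e) + 1 + 22
    e₃ = solve-∀

  i+e≡3*k : ∀ i k e → 4 * i + e ≡ 3 * (i + k) → i + e ≡ 3 * k
  i+e≡3*k i k e eq = +-cancelˡ-≡ (3 * i) (i + e) (3 * k) (begin
    3 * i + (i + e) ≡⟨ e₁ i e ⟩
    4 * i + e       ≡⟨ eq ⟩
    3 * (i + k)     ≡⟨ *-distribˡ-+ 3 i k ⟩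
    3 * i + 3 * k   ∎)
    where
    open ≡-Reasoning
    e₁ : ∀ i e → 3 * i + (i + e) ≡ 4 * i + e
    e₁ = solve-∀

  3^∣*m : ∀ T {B x} a b → 3 ^ B ∣ x → (∀ d → a + d ≡ 3 * b → T ≤ B + mExponent d) → 3 ^ T ∣ x * m a b
  3^∣*m T {B} a b 3^B∣x H =
    *-pres-^-∣ 3 B (m≤n+m∸n T B) 3^B∣x (3^∣m (T ∸ B) a b (λ d e → m≤n+o⇒m∸n≤o T B (H d e)))

  odd?-1+n*2 : ∀ n → odd? (1 + n * 2) ≡ true
  odd?-1+n*2 n = cong (_≡ᵇ 1) ([m+kn]%n≡m%n 1 n 2)

  odd?-2+n*2 : ∀ n → odd? (2 + n * 2) ≡ false
  odd?-2+n*2 n = cong (_≡ᵇ 1) ([m+kn]%n≡m%n 2 n 2)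

  c-even-recurrence : ∀ n k → c (2 + n * 2) k ≡ Σ₁ (3 * k) (λ i → c (1 + n * 2) i * m (4 * i) (i + k))
  c-even-recurrence n k rewrite odd?-1+n*2 n = refl

  c-odd-recurrence : ∀ n k → c (3 + n * 2) k ≡ Σ₁ (3 * k) (λ i → c (2 + n * 2) i * m (4 * i + 2) (i + k))
  c-odd-recurrence n k rewrite odd?-2+n*2 n = refl

  3^∣c-odd  : ∀ n k → 3 ^ (2 + n * 2 + cExponent k) ∣ c (1 + n * 2) k
  3^∣c-even : ∀ n k → 3 ^ (4 + n * 2 + cExponent k) ∣ c (2 + n * 2) k

  3^∣c-odd zero 0             = _ ∣0
  3^∣c-odd zero 1             = ∣-refl
  3^∣c-odd zero (suc (suc k)) = _ ∣0
  3^∣c-odd (suc n) k = subst (3 ^ T ∣_) (sym (c-odd-recurrence n k)) (Σ₁-pres-∣ (3 * k) _ term)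
    where
    T : ℕ
    T = 4 + n * 2 + cExponent k
    term : ∀ i → 1 ≤ i → 3 ^ T ∣ c (2 + n * 2) i * m (4 * i + 2) (i + k)
    term i 1≤i = 3^∣*m T (4 * i + 2) (i + k) (3^∣c-even n i) λ d eq →
      let i+2+d≡3k = i+e≡3*k i k (2 + d) (trans (sym (+-assoc (4 * i) 2 d)) eq) in
      ≤-trans (+-monoʳ-≤ (4 + n * 2) (cExponent-even-step {k = k} 1≤i i+2+d≡3k))
              (≤-reflexive (sym (+-assoc (4 + n * 2) (cExponent i) (mExponent d))))

  3^∣c-even n k = subst (3 ^ T ∣_) (sym (c-even-recurrence n k)) (Σ₁-pres-∣ (3 * k) _ term)
    where
    T : ℕ
    T = 4 + n * 2 + cExponent k
    shuffle : ∀ a c → 4 + a + c ≡ 2 + a + (c + 2)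
    shuffle = solve-∀
    term : ∀ i → 1 ≤ i → 3 ^ T ∣ c (1 + n * 2) i * m (4 * i) (i + k)
    term i 1≤i = 3^∣*m T (4 * i) (i + k) (3^∣c-odd n i) λ d eq →
      ≤-trans (≤-reflexive (shuffle (n * 2) (cExponent k)))
        (≤-trans (+-monoʳ-≤ (2 + n * 2) (cExponent-odd-step {k = k} 1≤i (i+e≡3*k i k d eq)))
                 (≤-reflexive (sym (+-assoc (2 + n * 2) (cExponent i) (mExponent d)))))

  3^∣⇒≤val3 : ∀ fuel x n → 1 ≤ x → x ≤ fuel → 3 ^ n ∣ x → n ≤ val3 fuel x
  3^∣⇒≤val3 fuel       x       zero    _  _      _ = z≤n
  3^∣⇒≤val3 zero       (suc x) (suc n) _  ()     _
  3^∣⇒≤val3 (suc fuel) (suc x) (suc n) _  x≤fuel 3^n∣x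
    rewrite n∣m⇒m%n≡0 (suc x) 3 (∣-trans (m∣m*n (3 ^ n)) 3^n∣x) =
    s≤s (3^∣⇒≤val3 fuel (suc x / 3) n (m≥n⇒m/n>0 (∣⇒≤ 3∣x))
                   (s≤s⁻¹ (≤-trans (m/n<m (suc x) 3 (s≤s (s≤s z≤n))) x≤fuel))
                   (m*n∣o⇒n∣o/m 3 (3 ^ n) 3^n∣x))
    where
    3∣x : 3 ∣ suc x
    3∣x = ∣-trans (m∣m*n (3 ^ n)) 3^n∣x

  3^∣⇒≤∞ν₃ : ∀ n x → 3 ^ n ∣ x → ℤ.+ n ≤∞ ν₃ x
  3^∣⇒≤∞ν₃ n zero    _     = _
  3^∣⇒≤∞ν₃ n (suc x) 3^n∣x = ℤ.+≤+ (3^∣⇒≤val3 (suc x) (suc x) n (s≤s z≤n) ≤-refl 3^n∣x)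

open PowersOfThree

open import Data.Nat using (ℕ; _*_; _∸_; _≤_; _^_; zero; suc; s≤s; z≤n)
import Data.Nat
open import Data.Nat.Divisibility using (_∣_)
import Data.Nat.Properties as ℕ
open import Data.Integer using (+_; _+_)
open import Data.Integer.DivMod using (_/_; div-pos-is-/ℕ)
open import Data.Integer.Properties using (+-assoc; +-identityˡ; m-n≡m⊖n; ⊖-≥)
open import Data.Product using (_×_; _,_)
open import Relation.Binary.PropositionalEquality

δ₁+fl≡cExponent : ∀ k → 1 ≤ k → δ₁ k + fl k ≡ + cExponent k
δ₁+fl≡cExponent (suc zero)    _ = refl
δ₁+fl≡cExponent k@(suc (suc _)) _ = begin
  + 0 + fl k           ≡⟨ +-identityˡ _ ⟩
  fl k                 ≡⟨ cong (_/ + 2) (trans (m-n≡m⊖n (9 * k) 10) (⊖-≥ 10≤9*k)) ⟩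
  + (9 * k ∸ 10) / + 2 ≡⟨ div-pos-is-/ℕ (+ (9 * k ∸ 10)) 2 ⟩
  + cExponent k        ∎
  where
  open ≡-Reasoning
  10≤9*k : 10 ≤ 9 * k
  10≤9*k = ℕ.≤-trans (ℕ.m≤m+n 10 8) (ℕ.*-monoʳ-≤ 9 (s≤s (s≤s z≤n)))

ν₃-lower-bound : ∀ a k x → 1 ≤ k → 3 ^ (a Data.Nat.+ cExponent k) ∣ x → + a + δ₁ k + fl k ≤∞ ν₃ x
ν₃-lower-bound a k x 1≤k 3^∣x = subst (_≤∞ ν₃ x) (sym exponent) (3^∣⇒≤∞ν₃ _ x 3^∣x)
  where
  exponent : + a + δ₁ k + fl k ≡ + (a Data.Nat.+ cExponent k)
  exponent = trans (+-assoc (+ a) (δ₁ k) (fl k)) (cong (_+_ (+ a)) (δ₁+fl≡cExponent k 1≤k))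

lemma3p8 : (j k : ℕ) → 1 ≤ j → 1 ≤ k →
    (+ (2 * j) + δ₁ k + fl k ≤∞ ν₃ (c (2 * j ∸ 1) k))
    × (+ (2 * j Data.Nat.+ 2) + δ₁ k + fl k ≤∞ ν₃ (c (2 * j) k))
lemma3p8 (suc n) k _ 1≤k = subst Bounds (ℕ.*-comm (suc n) 2) (odd , even)
  where
  Bounds : ℕ → Set
  Bounds t = (+ t + δ₁ k + fl k ≤∞ ν₃ (c (t ∸ 1) k))
           × (+ (t Data.Nat.+ 2) + δ₁ k + fl k ≤∞ ν₃ (c t k))
  odd : + suc (suc (n * 2)) + δ₁ k + fl k ≤∞ ν₃ (c (suc (n * 2)) k)
  odd = ν₃-lower-bound _ k _ 1≤k (3^∣c-odd n k)
  even : + (suc (suc (n * 2)) Data.Nat.+ 2) + δ₁ k + fl k ≤∞ ν₃ (c (suc (suc (n * 2))) k)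
  even = ν₃-lower-bound _ k _ 1≤k
    (subst (λ a → 3 ^ (a Data.Nat.+ cExponent k) ∣ c (suc (suc (n * 2))) k)
           (ℕ.+-comm 2 (suc (suc (n * 2)))) (3^∣c-even n k))
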